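{- Let $m\ge1$, $s$, $\ell$ be integers, and let $n=sm+s-\ell$. If $\ell\ge2$ and $s\ge\frac32\ell+m$, then \[ \binom{n-m-\ell+1}{m-1}>\frac{\ell}{2}\sum_{i=1}^{m-1}\binom{n-1}{i-1}. \] -}

module Defs where

open import Data.Nat using (ℕ; zero; suc; _+_)

ΣBelow : ℕ → (ℕ → ℕ) → ℕ
ΣBelow zero f = 0
ΣBelow (suc k) f = ΣBelow k f + f k

{-# OPTIONS --safe #-}
-- Put a = m − 2, N = n − 1 and A = n + 1 − m − ℓ; the claim is ℓ · Σ_{j≤a} C(N,j) < 2 · C(A,a+1).
-- Three ratio estimates reduce it to a polynomial inequality.
--  * For j < a the ratio C(N,j+1)/C(N,j) = (N−j)/(j+1) is at least (a+P)/a with P = N + 1 − 2a,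
--    so the sum is dominated by a geometric series: Σ_{j≤a} C(N,j) · P ≤ C(N,a) · (a+P).
--  * Pascal's rule gives C(N,a) − C(A,a) ≤ (N−A) · C(N−1,a−1) = (N−A) · a/N · C(N,a), that is
--    (N − (a+ℓ)a) · C(N,a) ≤ N · C(A,a).
--  * Absorption gives (a+1) · C(A,a+1) = (A−a) · C(A,a).
-- What remains is ℓ(a+1)(a+P)N < 2P(A−a)(N−(a+ℓ)a). It splits into (a+P)N ≤ P(N+a+2), true as a² ≤ P,
-- and ℓ(a+1)(N+a+2) < 2(A−a)(N−(a+ℓ)a), and both follow from (3ℓ+2m)(m+1) ≤ 2s(m+1) = 2(n+ℓ).
module Submission where

open import Algebra.Properties.CommutativeSemigroup using (x∙yz≈y∙xz)
open import Data.List using ([]; _∷_)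
open import Data.Nat using (ℕ; zero; suc; _+_; _*_; _∸_; _≤_; _<_; z≤n; s≤s; NonZero; >-nonZero)
open import Data.Nat.Combinatorics using (_C_; nC1≡n; nCk+nC[k+1]≡[n+1]C[k+1])
open import Data.Nat.Properties
open import Data.Nat.Tactic.RingSolver using (solve)
open import Data.Product using (∃-syntax; _×_; _,_; proj₁; proj₂)
open import Relation.Binary.PropositionalEquality
  using (_≡_; refl; sym; trans; cong; cong₂; subst; module ≡-Reasoning)

open import Defs

m+[n+o]≡n+[m+o] : ∀ m n o → m + (n + o) ≡ n + (m + o)
m+[n+o]≡n+[m+o] = x∙yz≈y∙xz +-commutativeSemigroup

m*[n*o]≡n*[m*o] : ∀ m n o → m * (n * o) ≡ n * (m * o)
m*[n*o]≡n*[m*o] = x∙yz≈y∙xz *-commutativeSemigroup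

pascal : ∀ n k → suc n C suc k ≡ n C k + n C suc k
pascal n k = sym (nCk+nC[k+1]≡[n+1]C[k+1] n k)

[k+1]*[n+1]C[k+1]≡[n+1]*nCk : ∀ n k → suc k * (suc n C suc k) ≡ suc n * (n C k)
[k+1]*[n+1]C[k+1]≡[n+1]*nCk zero    zero    = refl
[k+1]*[n+1]C[k+1]≡[n+1]*nCk zero    (suc k) = *-zeroʳ (suc (suc k))
[k+1]*[n+1]C[k+1]≡[n+1]*nCk (suc n) zero    = begin
  1 * (suc (suc n) C 1) ≡⟨ *-identityˡ _ ⟩
  suc (suc n) C 1       ≡⟨ nC1≡n (suc (suc n)) ⟩
  suc (suc n)           ≡⟨ *-identityʳ (suc (suc n)) ⟨
  suc (suc n) * 1       ∎
  where open ≡-Reasoning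
[k+1]*[n+1]C[k+1]≡[n+1]*nCk (suc n) (suc k) = begin
  suc (suc k) * (suc (suc n) C suc (suc k))
    ≡⟨ cong (suc (suc k) *_) (pascal (suc n) (suc k)) ⟩
  suc (suc k) * (suc n C suc k + suc n C suc (suc k))
    ≡⟨ step _ _ _ _ (pascal n k) ([k+1]*[n+1]C[k+1]≡[n+1]*nCk n k) ([k+1]*[n+1]C[k+1]≡[n+1]*nCk n (suc k)) ⟩
  suc (suc n) * (suc n C suc k)
    ∎
  where
  open ≡-Reasoning
  step : ∀ u v x y → u ≡ x + y → suc k * u ≡ suc n * x → suc (suc k) * v ≡ suc n * y →
         suc (suc k) * (u + v) ≡ suc (suc n) * u
  step u v x y u≡x+y ku≡nx kv≡ny = begin
    suc (suc k) * (u + v)           ≡⟨ solve (k ∷ u ∷ v ∷ []) ⟩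
    u + suc k * u + suc (suc k) * v ≡⟨ cong₂ (λ p q → u + p + q) ku≡nx kv≡ny ⟩
    u + suc n * x + suc n * y       ≡⟨ solve (u ∷ n ∷ x ∷ y ∷ []) ⟩
    u + suc n * (x + y)             ≡⟨ cong (λ w → u + suc n * w) u≡x+y ⟨
    suc (suc n) * u                 ∎

[k+1]*[nCk+nC[k+1]]≡[n+1]*nCk : ∀ n k → suc k * (n C k + n C suc k) ≡ suc n * (n C k)
[k+1]*[nCk+nC[k+1]]≡[n+1]*nCk n k =
  trans (cong (suc k *_) (sym (pascal n k))) ([k+1]*[n+1]C[k+1]≡[n+1]*nCk n k)

[k+1]*[k+m]C[k+1]≡m*[k+m]Ck : ∀ k m → suc k * ((k + m) C suc k) ≡ m * ((k + m) C k)
[k+1]*[k+m]C[k+1]≡m*[k+m]Ck k m = +-cancelˡ-≡ (suc k * c) _ _ (begin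
  suc k * c + suc k * ((k + m) C suc k) ≡⟨ *-distribˡ-+ (suc k) c _ ⟨
  suc k * (c + (k + m) C suc k)         ≡⟨ [k+1]*[nCk+nC[k+1]]≡[n+1]*nCk (k + m) k ⟩
  (suc k + m) * c                       ≡⟨ *-distribʳ-+ c (suc k) m ⟩
  suc k * c + m * c                     ∎)
  where
  open ≡-Reasoning
  c : ℕ
  c = (k + m) C k

k≤n⇒nCk>0 : ∀ {n k} → k ≤ n → 0 < n C k
k≤n⇒nCk>0 {n}     {zero}  _         = s≤s z≤n
k≤n⇒nCk>0 {suc n} {suc k} (s≤s k≤n) rewrite pascal n k = ≤-trans (k≤n⇒nCk>0 k≤n) (m≤m+n _ _)

nCk≤[n+1]Ck : ∀ n k → n C k ≤ suc n C k
nCk≤[n+1]Ck n zero    = ≤-refl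
nCk≤[n+1]Ck n (suc k) rewrite pascal n k = m≤n+m _ _

[d+x+1]C[k+1]≤xC[k+1]+[d+1]*[d+x]Ck : ∀ d x k → suc (d + x) C suc k ≤ x C suc k + suc d * ((d + x) C k)
[d+x+1]C[k+1]≤xC[k+1]+[d+1]*[d+x]Ck zero x k = ≤-reflexive (begin-equality
  suc x C suc k           ≡⟨ pascal x k ⟩
  x C k + x C suc k       ≡⟨ +-comm (x C k) _ ⟩
  x C suc k + x C k       ≡⟨ cong (x C suc k +_) (*-identityˡ (x C k)) ⟨
  x C suc k + 1 * (x C k) ∎)
  where open ≤-Reasoning
[d+x+1]C[k+1]≤xC[k+1]+[d+1]*[d+x]Ck (suc d) x k = begin
  suc (suc (d + x)) C suc k               ≡⟨ pascal (suc (d + x)) k ⟩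
  c + suc (d + x) C suc k                 ≤⟨ +-monoʳ-≤ c ([d+x+1]C[k+1]≤xC[k+1]+[d+1]*[d+x]Ck d x k) ⟩
  c + (x C suc k + suc d * ((d + x) C k)) ≤⟨ +-monoʳ-≤ c (+-monoʳ-≤ (x C suc k)
                                               (*-monoʳ-≤ (suc d) (nCk≤[n+1]Ck (d + x) k))) ⟩
  c + (x C suc k + suc d * c)             ≡⟨ m+[n+o]≡n+[m+o] c (x C suc k) (suc d * c) ⟩
  x C suc k + suc (suc d) * c             ∎
  where
  open ≤-Reasoning
  c : ℕ
  c = suc (d + x) C k

[d+x]*[d+x]Ck≤[d+x]*xCk+d*k*[d+x]Ck : ∀ d x k →
  (d + x) * ((d + x) C k) ≤ (d + x) * (x C k) + d * k * ((d + x) C k)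
[d+x]*[d+x]Ck≤[d+x]*xCk+d*k*[d+x]Ck d       x zero    = m≤m+n _ _
[d+x]*[d+x]Ck≤[d+x]*xCk+d*k*[d+x]Ck zero    x (suc k) = m≤m+n _ _
[d+x]*[d+x]Ck≤[d+x]*xCk+d*k*[d+x]Ck (suc d) x (suc k) = begin
  N * (N C suc k)                                 ≤⟨ *-monoʳ-≤ N ([d+x+1]C[k+1]≤xC[k+1]+[d+1]*[d+x]Ck d x k) ⟩
  N * (x C suc k + suc d * ((d + x) C k))         ≡⟨ *-distribˡ-+ N (x C suc k) _ ⟩
  N * (x C suc k) + N * (suc d * ((d + x) C k))   ≡⟨ cong (N * (x C suc k) +_) (m*[n*o]≡n*[m*o] N (suc d) _) ⟩
  N * (x C suc k) + suc d * (N * ((d + x) C k))   ≡⟨ cong (λ t → N * (x C suc k) + suc d * t)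
                                                       ([k+1]*[n+1]C[k+1]≡[n+1]*nCk (d + x) k) ⟨
  N * (x C suc k) + suc d * (suc k * (N C suc k)) ≡⟨ cong (N * (x C suc k) +_) (*-assoc (suc d) (suc k) _) ⟨
  N * (x C suc k) + suc d * suc k * (N C suc k)   ∎
  where
  open ≤-Reasoning
  N : ℕ
  N = suc (d + x)

nCj*q≤nC[j+1]*a : ∀ {n a q j} → a + q ≤ suc n → suc j ≤ a → (n C j) * q ≤ (n C suc j) * a
nCj*q≤nC[j+1]*a {n} {a} {q} {j} a+q≤1+n j<a =
  ratio (n C j) (n C suc j) ([k+1]*[nCk+nC[k+1]]≡[n+1]*nCk n j)
  where
  ratio : ∀ c c′ → suc j * (c + c′) ≡ suc n * c → c * q ≤ c′ * a
  ratio c c′ eq = *-cancelˡ-≤ (suc j) (+-cancelʳ-≤ (a * (suc j * c)) _ _ (begin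
    suc j * (c * q) + a * (suc j * c)  ≡⟨ solve (j ∷ c ∷ q ∷ a ∷ []) ⟩
    suc j * ((a + q) * c)              ≤⟨ *-monoˡ-≤ _ j<a ⟩
    a * ((a + q) * c)                  ≤⟨ *-monoʳ-≤ a (*-monoˡ-≤ c a+q≤1+n) ⟩
    a * (suc n * c)                    ≡⟨ cong (a *_) eq ⟨
    a * (suc j * (c + c′))             ≡⟨ solve (a ∷ j ∷ c ∷ c′ ∷ []) ⟩
    suc j * (c′ * a) + a * (suc j * c) ∎))
    where open ≤-Reasoning

ΣBelow-C-geometric : ∀ {n a P} → 2 * a + P ≤ suc n → ∀ j → j ≤ a →
  ΣBelow (suc j) (n C_) * P ≤ (n C j) * (a + P)
ΣBelow-C-geometric {_} {a} {P} _        zero    _   = +-monoˡ-≤ 0 (m≤n+m P a)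
ΣBelow-C-geometric {n} {a} {P} 2a+P≤1+n (suc j) j<a = begin
  (ΣBelow (suc j) (n C_) + n C suc j) * P     ≡⟨ *-distribʳ-+ P (ΣBelow (suc j) (n C_)) _ ⟩
  ΣBelow (suc j) (n C_) * P + (n C suc j) * P ≤⟨ +-monoˡ-≤ _ (ΣBelow-C-geometric 2a+P≤1+n j (<⇒≤ j<a)) ⟩
  (n C j) * (a + P) + (n C suc j) * P         ≤⟨ +-monoˡ-≤ _ (nCj*q≤nC[j+1]*a a+[a+P]≤1+n j<a) ⟩
  (n C suc j) * a + (n C suc j) * P           ≡⟨ *-distribˡ-+ (n C suc j) a P ⟨
  (n C suc j) * (a + P)                       ∎
  where
  open ≤-Reasoning
  a+[a+P]≡2a+P : a + (a + P) ≡ 2 * a + P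
  a+[a+P]≡2a+P = solve (a ∷ P ∷ [])
  a+[a+P]≤1+n : a + (a + P) ≤ suc n
  a+[a+P]≤1+n = ≤-trans (≤-reflexive a+[a+P]≡2a+P) 2a+P≤1+n

[a+P]*n≤P*[n+a+2] : ∀ a P n → n ≤ 2 * a + P → a * a ≤ P → (a + P) * n ≤ P * (n + (a + 2))
[a+P]*n≤P*[n+a+2] a P n n≤2a+P a²≤P = begin
  (a + P) * n                   ≡⟨ *-distribʳ-+ n a P ⟩
  a * n + P * n                 ≤⟨ +-monoˡ-≤ (P * n) (*-monoʳ-≤ a n≤2a+P) ⟩
  a * (2 * a + P) + P * n       ≡⟨ solve (a ∷ P ∷ n ∷ []) ⟩
  2 * (a * a) + (a * P + P * n) ≤⟨ +-monoˡ-≤ _ (*-monoʳ-≤ 2 a²≤P) ⟩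
  2 * P + (a * P + P * n)       ≡⟨ solve (a ∷ P ∷ n ∷ []) ⟩
  P * (n + (a + 2))             ∎
  where open ≤-Reasoning

x<y⇒x+c<z⇒x*[y+c]<y*z : ∀ {x y c z} → x < y → x + c < z → x * (y + c) < y * z
x<y⇒x+c<z⇒x*[y+c]<y*z {x} {y@(suc _)} {c} {z} x<y x+c<z = begin-strict
  x * (y + c)   ≡⟨ *-distribˡ-+ x y c ⟩
  x * y + x * c ≤⟨ +-monoʳ-≤ (x * y) (*-monoˡ-≤ c (<⇒≤ x<y)) ⟩
  x * y + y * c ≡⟨ cong (_+ y * c) (*-comm x y) ⟩
  y * x + y * c ≡⟨ *-distribˡ-+ y x c ⟨
  y * (x + c)   <⟨ *-monoʳ-< y x+c<z ⟩
  y * z         ∎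
  where open ≤-Reasoning

ratio-chain : ∀ {ℓ a S X Y Z P n n′ A′ M} → 0 < X → 0 < P →
  S * P ≤ X * (a + P) → (a + P) * n ≤ P * M → ℓ * suc a * M < A′ * (2 * n′) →
  n′ * X ≤ n * Y → suc a * Z ≡ A′ * Y → ℓ * S < 2 * Z
ratio-chain {ℓ} {a} {S} {X} {Y} {Z} {P} {n} {n′} {A′} {M} X>0 P>0 geometric excess main shift absorb =
  *-cancelʳ-< (P * n * suc a) (ℓ * S) (2 * Z) (begin-strict
    ℓ * S * (P * n * suc a)         ≡⟨ solve (ℓ ∷ S ∷ P ∷ n ∷ a ∷ []) ⟩
    ℓ * suc a * n * (S * P)         ≤⟨ *-monoʳ-≤ (ℓ * suc a * n) geometric ⟩
    ℓ * suc a * n * (X * (a + P))   ≡⟨ solve (ℓ ∷ a ∷ n ∷ X ∷ P ∷ []) ⟩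
    X * (ℓ * suc a * ((a + P) * n)) ≤⟨ *-monoʳ-≤ X (*-monoʳ-≤ (ℓ * suc a) excess) ⟩
    X * (ℓ * suc a * (P * M))       ≡⟨ solve (X ∷ ℓ ∷ a ∷ P ∷ M ∷ []) ⟩
    X * P * (ℓ * suc a * M)         <⟨ *-monoʳ-< (X * P) main ⟩
    X * P * (A′ * (2 * n′))         ≡⟨ solve (X ∷ P ∷ A′ ∷ n′ ∷ []) ⟩
    2 * P * A′ * (n′ * X)           ≤⟨ *-monoʳ-≤ (2 * P * A′) shift ⟩
    2 * P * A′ * (n * Y)            ≡⟨ solve (P ∷ A′ ∷ n ∷ Y ∷ []) ⟩
    2 * P * n * (A′ * Y)            ≡⟨ cong (2 * P * n *_) absorb ⟨
    2 * P * n * (suc a * Z)         ≡⟨ solve (P ∷ n ∷ a ∷ Z ∷ []) ⟩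
    2 * Z * (P * n * suc a)         ∎)
  where
  open ≤-Reasoning
  instance
    XP≢0 : NonZero (X * P)
    XP≢0 = m*n≢0 X P {{>-nonZero X>0}} {{>-nonZero P>0}}

≤-cancel-excess : ∀ {u v x r e y} → u ≤ v → u ≡ (x + r) + e → v ≡ y + e → x ≤ y
≤-cancel-excess {u} {v} {x} {r} {e} {y} u≤v u≡x+r+e v≡y+e = +-cancelʳ-≤ e x y (begin
  x + e       ≤⟨ +-monoˡ-≤ e (m≤m+n x r) ⟩
  (x + r) + e ≡⟨ u≡x+r+e ⟨
  u           ≤⟨ u≤v ⟩
  v           ≡⟨ v≡y+e ⟩
  y + e       ∎)
  where open ≤-Reasoning

≤-double-split : ∀ c d x → 2 * c + d ≤ 2 * x → ∃[ k ] x ≡ c + k × d ≤ 2 * k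
≤-double-split c d x 2c+d≤2x = k , sym c+k≡x , +-cancelˡ-≤ (2 * c) d (2 * k) (begin
  2 * c + d       ≤⟨ 2c+d≤2x ⟩
  2 * x           ≡⟨ cong (2 *_) c+k≡x ⟨
  2 * (c + k)     ≡⟨ *-distribˡ-+ 2 c k ⟩
  2 * c + 2 * k   ∎)
  where
  open ≤-Reasoning
  split : ∃[ k ] c + k ≡ x
  split = m≤n⇒∃[o]m+o≡n (*-cancelˡ-≤ 2 (≤-trans (m≤m+n (2 * c) d) 2c+d≤2x))
  k : ℕ
  k = proj₁ split
  c+k≡x : c + k ≡ x
  c+k≡x = proj₂ split

-- N = n − 1, A = n + 1 − m − ℓ and P = N + 1 − 2a for m = a + 2, parametrised by A′ = A − a.
module BinomialEstimate (a ℓ A′ : ℕ) where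

  A N P : ℕ
  A = a + A′
  N = (a + ℓ) + A
  P = suc (ℓ + A′)

  N′*NCa≤N*ACa : ∀ {N′} → N ≡ (a + ℓ) * a + N′ → N′ * (N C a) ≤ N * (A C a)
  N′*NCa≤N*ACa {N′} N≡ = +-cancelˡ-≤ ((a + ℓ) * a * X) _ _ (begin
    (a + ℓ) * a * X + N′ * X      ≡⟨ *-distribʳ-+ X ((a + ℓ) * a) N′ ⟨
    ((a + ℓ) * a + N′) * X        ≡⟨ cong (_* X) N≡ ⟨
    N * X                         ≤⟨ [d+x]*[d+x]Ck≤[d+x]*xCk+d*k*[d+x]Ck (a + ℓ) A a ⟩
    N * (A C a) + (a + ℓ) * a * X ≡⟨ +-comm (N * (A C a)) _ ⟩
    (a + ℓ) * a * X + N * (A C a) ∎)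
    where
    open ≤-Reasoning
    X : ℕ
    X = N C a

  ℓΣ<2C : ∀ {N′} → N ≡ (a + ℓ) * a + N′ → a * a + ℓ * suc a < A′ →
          ℓ * suc a + (3 * a + ℓ + 2) < 2 * N′ → ℓ * ΣBelow (suc a) (N C_) < 2 * (A C suc a)
  ℓΣ<2C {N′} N≡ A′-bound N′-bound =
    ratio-chain {ℓ = ℓ} {n′ = N′} {A′ = A′} (k≤n⇒nCk>0 a≤N) (s≤s z≤n) geometric excess main
      (N′*NCa≤N*ACa N≡) ([k+1]*[k+m]C[k+1]≡m*[k+m]Ck a A′)
    where
    1+N≡2a+P : suc ((a + ℓ) + (a + A′)) ≡ 2 * a + suc (ℓ + A′)
    1+N≡2a+P = solve (a ∷ ℓ ∷ A′ ∷ [])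
    N+[a+2]≡A′+[3a+ℓ+2] : (a + ℓ) + (a + A′) + (a + 2) ≡ A′ + (3 * a + ℓ + 2)
    N+[a+2]≡A′+[3a+ℓ+2] = solve (a ∷ ℓ ∷ A′ ∷ [])
    a≤N : a ≤ N
    a≤N = ≤-trans (m≤m+n a ℓ) (m≤m+n (a + ℓ) A)
    a²≤P : a * a ≤ P
    a²≤P = ≤-trans (m+n≤o⇒m≤o (a * a) (<⇒≤ A′-bound)) (≤-trans (m≤n+m A′ ℓ) (n≤1+n _))
    ℓ[a+1]<A′ : ℓ * suc a < A′
    ℓ[a+1]<A′ = m+n≤o⇒n≤o (a * a) (≤-trans (≤-reflexive (+-suc (a * a) _)) A′-bound)
    geometric : ΣBelow (suc a) (N C_) * P ≤ (N C a) * (a + P)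
    geometric = ΣBelow-C-geometric (≤-reflexive (sym 1+N≡2a+P)) a ≤-refl
    excess : (a + P) * N ≤ P * (N + (a + 2))
    excess = [a+P]*n≤P*[n+a+2] a P N (≤-trans (n≤1+n N) (≤-reflexive 1+N≡2a+P)) a²≤P
    main : ℓ * suc a * (N + (a + 2)) < A′ * (2 * N′)
    main = subst (λ M → ℓ * suc a * M < A′ * (2 * N′)) (sym N+[a+2]≡A′+[3a+ℓ+2])
             (x<y⇒x+c<z⇒x*[y+c]<y*z ℓ[a+1]<A′ N′-bound)

  threshold⇒A′-bound : (3 * ℓ + 2 * (2 + a)) * (3 + a) ≤ 2 * (suc N + ℓ) → a * a + ℓ * suc a < A′
  threshold⇒A′-bound t = *-cancelˡ-≤ 2 (≤-cancel-excess t lhs rhs)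
    where
    lhs : (3 * ℓ + 2 * (2 + a)) * (3 + a)
        ≡ (2 * suc (a * a + ℓ * suc a) + (ℓ * a + 3 * ℓ + 6 * a + 8)) + (4 * a + 4 * ℓ + 2)
    lhs = solve (a ∷ ℓ ∷ [])
    rhs : 2 * (suc ((a + ℓ) + (a + A′)) + ℓ) ≡ 2 * A′ + (4 * a + 4 * ℓ + 2)
    rhs = solve (a ∷ ℓ ∷ A′ ∷ [])

  -- Here the ℓ·a terms cancel exactly: this is where the factor 3/2 in s ≥ 3ℓ/2 + m is needed.
  threshold⇒N-bound : (3 * ℓ + 2 * (2 + a)) * (3 + a) ≤ 2 * (suc N + ℓ) →
                      2 * ((a + ℓ) * a) + suc (ℓ * suc a + (3 * a + ℓ + 2)) ≤ 2 * N
  threshold⇒N-bound t = ≤-cancel-excess t lhs rhs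
    where
    lhs : (3 * ℓ + 2 * (2 + a)) * (3 + a)
        ≡ (2 * ((a + ℓ) * a) + suc (ℓ * suc a + (3 * a + ℓ + 2)) + (5 * ℓ + 7 * a + 7)) + 2 * suc ℓ
    lhs = solve (a ∷ ℓ ∷ [])
    rhs : 2 * (suc ((a + ℓ) + (a + A′)) + ℓ) ≡ 2 * ((a + ℓ) + (a + A′)) + 2 * suc ℓ
    rhs = solve (a ∷ ℓ ∷ A′ ∷ [])

  [N+2]∸[2+a+ℓ]≡A : suc N + 1 ∸ (2 + a + ℓ) ≡ A
  [N+2]∸[2+a+ℓ]≡A = trans (cong (_∸ suc (a + ℓ)) (+-comm N 1)) (m+n∸m≡n (a + ℓ) A)

  threshold⇒ℓΣ<2C : ∀ {n} → n ≡ suc N → (3 * ℓ + 2 * (2 + a)) * (3 + a) ≤ 2 * (n + ℓ) →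
                    ℓ * ΣBelow (suc a) (λ j → (n ∸ 1) C j) < 2 * ((n + 1 ∸ (2 + a + ℓ)) C suc a)
  threshold⇒ℓΣ<2C refl t =
    subst (λ B → ℓ * ΣBelow (suc a) (N C_) < 2 * (B C suc a)) (sym [N+2]∸[2+a+ℓ]≡A)
      (ℓΣ<2C (proj₁ (proj₂ split)) (threshold⇒A′-bound t) (proj₂ (proj₂ split)))
    where
    split : ∃[ N′ ] N ≡ (a + ℓ) * a + N′ × suc (ℓ * suc a + (3 * a + ℓ + 2)) ≤ 2 * N′
    split = ≤-double-split ((a + ℓ) * a) _ N (threshold⇒N-bound t)

threshold⇒∃A′ : ∀ a ℓ n → (3 * ℓ + 2 * (2 + a)) * (3 + a) ≤ 2 * (n + ℓ) →
  ∃[ A′ ] n ≡ suc ((a + ℓ) + (a + A′))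
threshold⇒∃A′ a ℓ n t = A′ , trans (sym a+ℓ+a+1+A′≡n) (cong suc (+-assoc (a + ℓ) a A′))
  where
  lhs : (3 * ℓ + 2 * (2 + a)) * (3 + a)
      ≡ (2 * suc ((a + ℓ) + a) + (3 * ℓ * a + 5 * ℓ + 2 * (a * a) + 6 * a + 10)) + 2 * ℓ
  lhs = solve (a ∷ ℓ ∷ [])
  split : ∃[ A′ ] suc ((a + ℓ) + a) + A′ ≡ n
  split = m≤n⇒∃[o]m+o≡n (*-cancelˡ-≤ 2 (≤-cancel-excess t lhs (*-distribˡ-+ 2 n ℓ)))
  A′ : ℕ
  A′ = proj₁ split
  a+ℓ+a+1+A′≡n : suc ((a + ℓ) + a) + A′ ≡ n
  a+ℓ+a+1+A′≡n = proj₂ split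

threshold⇒sum-bound : ∀ m ℓ n → 1 ≤ m → (3 * ℓ + 2 * m) * suc m ≤ 2 * (n + ℓ) →
  ℓ * ΣBelow (m ∸ 1) (λ j → (n ∸ 1) C j) < 2 * ((n + 1 ∸ (m + ℓ)) C (m ∸ 1))
threshold⇒sum-bound (suc zero)    ℓ n _ _ = subst (_< 2) (sym (*-zeroʳ ℓ)) (s≤s z≤n)
threshold⇒sum-bound (suc (suc a)) ℓ n _ t =
  BinomialEstimate.threshold⇒ℓΣ<2C a ℓ (proj₁ split) (proj₂ split) t
  where
  split : ∃[ A′ ] n ≡ suc ((a + ℓ) + (a + A′))
  split = threshold⇒∃A′ a ℓ n t

mainTheorem5 : (m s ℓ n : ℕ) → 1 ≤ m → 2 ≤ ℓ → 3 * ℓ + 2 * m ≤ 2 * s →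
    n + ℓ ≡ s * m + s →
    ℓ * ΣBelow (m ∸ 1) (λ j → (n ∸ 1) C j) < 2 * ((n + 1 ∸ (m + ℓ)) C (m ∸ 1))
mainTheorem5 m s ℓ n 1≤m _ 3ℓ+2m≤2s n+ℓ≡sm+s = threshold⇒sum-bound m ℓ n 1≤m (begin
  (3 * ℓ + 2 * m) * suc m ≤⟨ *-monoˡ-≤ (suc m) 3ℓ+2m≤2s ⟩
  2 * s * suc m           ≡⟨ *-assoc 2 s (suc m) ⟩
  2 * (s * suc m)         ≡⟨ cong (2 *_) (trans (*-suc s m) (+-comm s (s * m))) ⟩
  2 * (s * m + s)         ≡⟨ cong (2 *_) n+ℓ≡sm+s ⟨
  2 * (n + ℓ)             ∎)
  where open ≤-Reasoning
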